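{- Let $m\ge 2$ and $n\ge 0$ be integers. If $r\in\mathbb{Q}$ is a root of $p_m(n,t)$, then $r\in\{ -1,0\}$.
   Context: The $m$-ary partition polynomials $p_m(n,t)$ are defined by the power series expansion $\prod_{j=0}^{\infty}\frac{1}{1-tq^{m^j}}=\sum_{n=0}^{\infty}p_m(n,t)q^n$. -}

module Defs where

open import Data.Nat using (ℕ; zero; suc; _≤ᵇ_) renaming (_*_ to _*ℕ_; _∸_ to _∸ℕ_; _^_ to _^ℕ_)
open import Data.Rational using (ℚ; 0ℚ; 1ℚ; _+_; _*_)
open import Data.Bool using (Bool; true; false)

powℚ : ℚ → ℕ → ℚ
powℚ t zero    = 1ℚ
powℚ t (suc i) = t * powℚ t i

sumTo : ℕ → (ℕ → ℚ) → ℚ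
sumTo zero    f = f zero
sumTo (suc k) f = sumTo k f + f (suc k)

-- partial m J n t : coefficient of q^n in  ∏_{j=0}^{J-1} 1/(1 - t q^{m^j}),
-- evaluated at t.  Multiplying by 1/(1 - t q^a) = Σ_i t^i q^{i a}
-- (a = m^J) gives the coefficient  Σ_{i : i a ≤ n} t^i · partial m J (n - i a) t.
partial : ℕ → ℕ → ℕ → ℚ → ℚ
partial m zero    zero    t = 1ℚ
partial m zero    (suc n) t = 0ℚ
partial m (suc J) n       t =
  sumTo n (λ i → term i (i *ℕ (m ^ℕ J) ≤ᵇ n))
  where
  term : ℕ → Bool → ℚ
  term i true  = powℚ t i * partial m J (n ∸ℕ i *ℕ (m ^ℕ J)) t
  term i false = 0ℚ

-- For m ≥ 2 the factors with j ≥ n+1 have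
-- m^j > n and do not affect the coefficient of q^n, so the truncation
-- to j ∈ {0,…,n} gives the full infinite product's coefficient.
pm : ℕ → ℕ → ℚ → ℚ
pm m n t = partial m (suc n) n t

{-# OPTIONS --safe #-}
-- Write a root as r = a / b in lowest terms.  Clearing denominators, b ^ n · p_m(n, a / b)
-- is the integer binary form Σ a ^ ℓ(λ) · b ^ (n ∸ ℓ(λ)) over the m-ary partitions λ of n,
-- ℓ(λ) being the number of parts.  Only 1 + ⋯ + 1 has n parts, so the form is a ^ n modulo b,
-- and a root forces b ∣ a ^ n, i.e. b = 1.  Only the greedy partition has the fewest number w
-- of parts, so for b = 1 the form is a ^ w modulo a ^ (w + 1), and a nonzero integer root
-- divides 1.  Finally p_m(n, 1) counts partitions, so it is positive and a = 1 is no root.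

module Submission where

open import Defs
open import Data.Bool using (true; false; if_then_else_)
open import Data.Empty using (⊥-elim)
open import Data.Nat as ℕ using (ℕ; zero; suc; _≤_; _<_)
import Data.Nat.Properties as ℕₚ
open import Data.Nat.DivMod
  using (_/_; _%_; m≡m%n+[m/n]*n; m/n≤m; m%n<n; m*n/n≡m; [m+kn]%n≡m%n; +-distrib-/-∣ʳ)
open import Data.Nat.Divisibility using (∣1⇒≡1; divides-refl) renaming (_∣_ to _∣ℕ_)
open import Data.Nat.Coprimality using (Coprime; coprime-divisor; recompute) renaming (sym to coprime-sym)
import Data.Nat.Tactic.RingSolver as ℕ-Solver
open import Data.Integer as ℤ using (ℤ; +_; -[1+_]; 0ℤ; 1ℤ; -1ℤ)
import Data.Integer.Properties as ℤₚ
open import Data.Integer.Divisibility.Signed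
  using (_∣_; divides; ∣-refl; ∣-trans; ∣m∣n⇒∣m+n; ∣m⇒∣-m; ∣n⇒∣m*n; ∣m⇒∣m*n; *-monoʳ-∣; *-cancelʳ-∣; 0∣⇒≡0; ∣⇒∣ᵤ)
open import Data.Integer.Tactic.RingSolver using (solve-∀)
open import Data.Rational as ℚ using (ℚ; mkℚ; 0ℚ; 1ℚ; -_; ↥_; ↧_; ↧ₙ_)
import Data.Rational.Properties as ℚₚ
open import Data.Rational.Literals using (fromℤ)
open import Data.Rational.Solver using (module +-*-Solver)
import Data.Rational.Unnormalised as ℚᵘ
import Data.Rational.Unnormalised.Properties as ℚᵘₚ
open import Data.Sum using (_⊎_; inj₁; inj₂)
open import Function using (_∘_)
open import Relation.Nullary using (yes; no; ofʸ; ofⁿ)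
open import Relation.Binary.PropositionalEquality

fromℤ-+ : ∀ x y → fromℤ (x ℤ.+ y) ≡ fromℤ x ℚ.+ fromℤ y
fromℤ-+ x y = ℚₚ.toℚᵘ-injective
  (ℚᵘₚ.≃-trans (ℚᵘ.*≡* eq) (ℚᵘₚ.≃-sym (ℚₚ.toℚᵘ-homo-+ (fromℤ x) (fromℤ y))))
  where
  eq : (x ℤ.+ y) ℤ.* 1ℤ ≡ (x ℤ.* 1ℤ ℤ.+ y ℤ.* 1ℤ) ℤ.* 1ℤ
  eq = cong (ℤ._* 1ℤ) (sym (cong₂ ℤ._+_ (ℤₚ.*-identityʳ x) (ℤₚ.*-identityʳ y)))

fromℤ-* : ∀ x y → fromℤ (x ℤ.* y) ≡ fromℤ x ℚ.* fromℤ y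
fromℤ-* x y = ℚₚ.toℚᵘ-injective
  (ℚᵘₚ.≃-trans (ℚᵘ.*≡* refl) (ℚᵘₚ.≃-sym (ℚₚ.toℚᵘ-homo-* (fromℤ x) (fromℤ y))))

fromℤ-^ : ∀ x k → fromℤ (x ℤ.^ k) ≡ powℚ (fromℤ x) k
fromℤ-^ x zero    = refl
fromℤ-^ x (suc k) = trans (fromℤ-* x (x ℤ.^ k)) (cong (fromℤ x ℚ.*_) (fromℤ-^ x k))

↧p*p≡↥p : ∀ p → fromℤ (↧ p) ℚ.* p ≡ fromℤ (↥ p)
↧p*p≡↥p p@(mkℚ n d _) = ℚₚ.toℚᵘ-injective
  (ℚᵘₚ.≃-trans (ℚₚ.toℚᵘ-homo-* (fromℤ (↧ p)) p) (ℚᵘ.*≡* eq))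
  where
  eq : (+ suc d ℤ.* n) ℤ.* 1ℤ ≡ n ℤ.* (1ℤ ℤ.* + suc d)
  eq = trans (ℤₚ.*-identityʳ _) (trans (ℤₚ.*-comm (+ suc d) n) (cong (n ℤ.*_) (sym (ℤₚ.*-identityˡ _))))

powℚ-distribˡ-+-* : ∀ x i j → powℚ x (i ℕ.+ j) ≡ powℚ x i ℚ.* powℚ x j
powℚ-distribˡ-+-* x zero    j = sym (ℚₚ.*-identityˡ _)
powℚ-distribˡ-+-* x (suc i) j = trans (cong (x ℚ.*_) (powℚ-distribˡ-+-* x i j)) (sym (ℚₚ.*-assoc x _ _))

powℚ-distribʳ-* : ∀ x y i → powℚ (x ℚ.* y) i ≡ powℚ x i ℚ.* powℚ y i
powℚ-distribʳ-* x y zero    = refl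
powℚ-distribʳ-* x y (suc i) = trans (cong ((x ℚ.* y) ℚ.*_) (powℚ-distribʳ-* x y i)) (interchange x y _ _)
  where
  open +-*-Solver
  interchange : ∀ x y u v → (x ℚ.* y) ℚ.* (u ℚ.* v) ≡ (x ℚ.* u) ℚ.* (y ℚ.* v)
  interchange = solve 4 (λ x y u v → (x :* y) :* (u :* v) := (x :* u) :* (y :* v)) refl

sumTo-cong : ∀ n {f g : ℕ → ℚ} → (∀ i → f i ≡ g i) → sumTo n f ≡ sumTo n g
sumTo-cong zero    f≗g = f≗g zero
sumTo-cong (suc n) f≗g = cong₂ ℚ._+_ (sumTo-cong n f≗g) (f≗g (suc n))

*-distribˡ-sumTo : ∀ c n (f : ℕ → ℚ) → c ℚ.* sumTo n f ≡ sumTo n (λ i → c ℚ.* f i)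
*-distribˡ-sumTo c zero    f = refl
*-distribˡ-sumTo c (suc n) f =
  trans (ℚₚ.*-distribˡ-+ c (sumTo n f) (f (suc n))) (cong (ℚ._+ (c ℚ.* f (suc n))) (*-distribˡ-sumTo c n f))

termℚ : ℕ → ℕ → ℕ → ℚ → ℕ → ℚ
termℚ m J n t i =
  if i ℕ.* m ℕ.^ J ℕ.≤ᵇ n then powℚ t i ℚ.* partial m J (n ℕ.∸ i ℕ.* m ℕ.^ J) t else 0ℚ

-- The summand of partial is a where-bound function of Defs and cannot be
-- named, so the left-hand side of partial-summand is inferred from its use.
mutual
  partial-suc : ∀ m J n t → partial m (suc J) n t ≡ sumTo n (termℚ m J n t)
  partial-suc m J n t = sumTo-cong n (partial-summand m J n t)

  partial-summand : ∀ m J n t i → _ ≡ termℚ m J n t i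
  partial-summand m J n t i with i ℕ.* m ℕ.^ J ℕ.≤ᵇ n
  ... | true  = refl
  ... | false = refl

sumℤ : ℕ → (ℕ → ℤ) → ℤ
sumℤ zero    f = f zero
sumℤ (suc n) f = sumℤ n f ℤ.+ f (suc n)

fromℤ-sumℤ : ∀ n (f : ℕ → ℤ) → fromℤ (sumℤ n f) ≡ sumTo n (fromℤ ∘ f)
fromℤ-sumℤ zero    f = refl
fromℤ-sumℤ (suc n) f =
  trans (fromℤ-+ (sumℤ n f) (f (suc n))) (cong (ℚ._+ fromℤ (f (suc n))) (fromℤ-sumℤ n f))

∣0ℤ : ∀ {d} → d ∣ 0ℤ
∣0ℤ = divides 0ℤ refl

∣-sumℤ : ∀ {d} n (f : ℕ → ℤ) → (∀ i → i ≤ n → d ∣ f i) → d ∣ sumℤ n f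
∣-sumℤ zero    f d∣f = d∣f zero ℕ.z≤n
∣-sumℤ (suc n) f d∣f =
  ∣m∣n⇒∣m+n (∣-sumℤ n f (λ i i≤n → d∣f i (ℕₚ.m≤n⇒m≤1+n i≤n))) (d∣f (suc n) ℕₚ.≤-refl)

∣-sumℤ-single : ∀ {d c q} n (f : ℕ → ℤ) → q ≤ n → d ∣ f q ℤ.- c → (∀ i → i ≢ q → d ∣ f i) →
                d ∣ sumℤ n f ℤ.- c
∣-sumℤ-single zero f ℕ.z≤n d∣fq-c _ = d∣fq-c
∣-sumℤ-single {d} {c} {q} (suc n) f q≤1+n d∣fq-c d∣f with q ℕ.≟ suc n
... | yes refl = subst (d ∣_) (sym (ℤₚ.+-assoc (sumℤ n f) (f q) (ℤ.- c)))
  (∣m∣n⇒∣m+n (∣-sumℤ n f (λ i i≤n → d∣f i (ℕₚ.<⇒≢ (ℕ.s≤s i≤n)))) d∣fq-c)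
... | no q≢1+n = subst (d ∣_) (swap (sumℤ n f) (f (suc n)) c)
  (∣m∣n⇒∣m+n (∣-sumℤ-single n f (ℕₚ.≤-pred (ℕₚ.≤∧≢⇒< q≤1+n q≢1+n)) d∣fq-c d∣f)
              (d∣f (suc n) (q≢1+n ∘ sym)))
  where
  swap : ∀ x y c → (x ℤ.- c) ℤ.+ y ≡ x ℤ.+ y ℤ.- c
  swap = solve-∀

sumℤ-single : ∀ {q} n (f : ℕ → ℤ) → q ≤ n → (∀ i → i ≢ q → f i ≡ 0ℤ) → sumℤ n f ≡ f q
sumℤ-single {q} n f q≤n f≡0 = ℤₚ.i-j≡0⇒i≡j _ _
  (0∣⇒≡0 (∣-sumℤ-single n f q≤n (subst (0ℤ ∣_) (sym (ℤₚ.+-inverseʳ (f q))) ∣0ℤ)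
                                   (λ i i≢q → subst (0ℤ ∣_) (sym (f≡0 i i≢q)) ∣0ℤ)))

f0≤sumℤ : ∀ n (f : ℕ → ℤ) → (∀ i → 0ℤ ℤ.≤ f i) → f 0 ℤ.≤ sumℤ n f
f0≤sumℤ zero    f 0≤f = ℤₚ.≤-refl
f0≤sumℤ (suc n) f 0≤f = ℤₚ.≤-trans (f0≤sumℤ n f 0≤f)
  (subst (ℤ._≤ sumℤ (suc n) f) (ℤₚ.+-identityʳ (sumℤ n f)) (ℤₚ.+-monoʳ-≤ (sumℤ n f) (0≤f (suc n))))

m+[n∸m]+[o∸n]≡o : ∀ {m n o} → m ≤ n → n ≤ o → m ℕ.+ (n ℕ.∸ m) ℕ.+ (o ℕ.∸ n) ≡ o
m+[n∸m]+[o∸n]≡o {n = n} {o} m≤n n≤o = trans (cong (ℕ._+ (o ℕ.∸ n)) (ℕₚ.m+[n∸m]≡n m≤n)) (ℕₚ.m+[n∸m]≡n n≤o)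

[m+n]∸[o+p]≡[m∸o]+[n∸p] : ∀ {m n o p} → o ≤ m → p ≤ n → (m ℕ.+ n) ℕ.∸ (o ℕ.+ p) ≡ (m ℕ.∸ o) ℕ.+ (n ℕ.∸ p)
[m+n]∸[o+p]≡[m∸o]+[n∸p] {m} {n} {o} {p} o≤m p≤n = begin
  (m ℕ.+ n) ℕ.∸ (o ℕ.+ p)   ≡⟨ ℕₚ.∸-+-assoc (m ℕ.+ n) o p ⟨
  (m ℕ.+ n) ℕ.∸ o ℕ.∸ p     ≡⟨ cong (ℕ._∸ p) (ℕₚ.+-∸-comm n o≤m) ⟩
  (m ℕ.∸ o) ℕ.+ n ℕ.∸ p     ≡⟨ ℕₚ.+-∸-assoc (m ℕ.∸ o) p≤n ⟩
  (m ℕ.∸ o) ℕ.+ (n ℕ.∸ p)   ∎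
  where open ≡-Reasoning

m+n*o∸p*o≡m+[n∸p]*o : ∀ m {n p} o → p ≤ n → (m ℕ.+ n ℕ.* o) ℕ.∸ p ℕ.* o ≡ m ℕ.+ (n ℕ.∸ p) ℕ.* o
m+n*o∸p*o≡m+[n∸p]*o m {n} {p} o p≤n =
  trans (ℕₚ.+-∸-assoc m (ℕₚ.*-monoˡ-≤ o p≤n)) (cong (m ℕ.+_) (sym (ℕₚ.*-distribʳ-∸ o n p)))

0<e⇒x∣x^e : ∀ {x : ℤ} {e} → 0 < e → x ∣ x ℤ.^ e
0<e⇒x∣x^e {x} {suc e} _ = divides (x ℤ.^ e) (ℤₚ.*-comm x (x ℤ.^ e))

^-mono-∣ : ∀ (x : ℤ) {u v} → u ≤ v → x ℤ.^ u ∣ x ℤ.^ v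
^-mono-∣ x {u} {v} u≤v = divides (x ℤ.^ (v ℕ.∸ u))
  (trans (cong (x ℤ.^_) (sym (ℕₚ.m+[n∸m]≡n u≤v)))
         (trans (ℤₚ.^-distribˡ-+-* x u (v ℕ.∸ u)) (ℤₚ.*-comm (x ℤ.^ u) _)))

∣m-n∣n⇒∣m : ∀ {d m n} → d ∣ m ℤ.- n → d ∣ n → d ∣ m
∣m-n∣n⇒∣m {d} {m} {n} d∣m-n d∣n = subst (d ∣_) (m-n+n≡m m n) (∣m∣n⇒∣m+n d∣m-n d∣n)
  where
  m-n+n≡m : ∀ m n → m ℤ.- n ℤ.+ n ≡ m
  m-n+n≡m = solve-∀

m≡0⇒∣m-n⇒∣n : ∀ {d m n} → m ≡ 0ℤ → d ∣ m ℤ.- n → d ∣ n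
m≡0⇒∣m-n⇒∣n {d} {n = n} refl d∣0-n =
  subst (d ∣_) (ℤₚ.neg-involutive n) (∣m⇒∣-m (subst (d ∣_) (ℤₚ.+-identityˡ (ℤ.- n)) d∣0-n))

1*[1*x]≡x : ∀ x → 1ℤ ℤ.* (1ℤ ℤ.* x) ≡ x
1*[1*x]≡x x = trans (ℤₚ.*-identityˡ _) (ℤₚ.*-identityˡ x)

module Homogenised (k : ℕ) (a b : ℤ) where

  m : ℕ
  m = suc (suc k)

  m^J≢0 : ∀ J → ℕ.NonZero (m ℕ.^ J)
  m^J≢0 J = ℕₚ.m^n≢0 m J

  mutual
    partialℤ : ℕ → ℕ → ℤ
    partialℤ zero    zero    = 1ℤ
    partialℤ zero    (suc n) = 0ℤ
    partialℤ (suc J) n       = sumℤ n (termℤ J n)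

    termℤ : ℕ → ℕ → ℕ → ℤ
    termℤ J n i = if i ℕ.* m ℕ.^ J ℕ.≤ᵇ n
      then a ℤ.^ i ℤ.* (b ℤ.^ (i ℕ.* m ℕ.^ J ℕ.∸ i) ℤ.* partialℤ J (n ℕ.∸ i ℕ.* m ℕ.^ J))
      else 0ℤ

  module _ {t : ℚ} (b*t≡a : fromℤ b ℚ.* t ≡ fromℤ a) where

    fromℤ-partialℤ : ∀ J n → fromℤ (partialℤ J n) ≡ powℚ (fromℤ b) n ℚ.* partial m J n t
    fromℤ-partialℤ zero    zero    = refl
    fromℤ-partialℤ zero    (suc n) = sym (ℚₚ.*-zeroʳ (powℚ (fromℤ b) (suc n)))
    fromℤ-partialℤ (suc J) n = begin
      fromℤ (sumℤ n (termℤ J n))                    ≡⟨ fromℤ-sumℤ n (termℤ J n) ⟩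
      sumTo n (fromℤ ∘ termℤ J n)                    ≡⟨ sumTo-cong n fromℤ-termℤ ⟩
      sumTo n (λ i → powℚ B n ℚ.* termℚ m J n t i)  ≡⟨ *-distribˡ-sumTo (powℚ B n) n (termℚ m J n t) ⟨
      powℚ B n ℚ.* sumTo n (termℚ m J n t)           ≡⟨ cong (powℚ B n ℚ.*_) (partial-suc m J n t) ⟨
      powℚ B n ℚ.* partial m (suc J) n t             ∎
      where
      open ≡-Reasoning
      B = fromℤ b
      M = m ℕ.^ J

      rearrange : ∀ bi ti be bn p → bi ℚ.* ti ℚ.* (be ℚ.* (bn ℚ.* p)) ≡ bi ℚ.* be ℚ.* bn ℚ.* (ti ℚ.* p)
      rearrange = solve 5 (λ bi ti be bn p → bi :* ti :* (be :* (bn :* p)) := bi :* be :* bn :* (ti :* p)) refl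
        where open +-*-Solver

      fromℤ-termℤ : ∀ i → fromℤ (termℤ J n i) ≡ powℚ B n ℚ.* termℚ m J n t i
      fromℤ-termℤ i with i ℕ.* M ℕ.≤ᵇ n | ℕₚ.≤ᵇ-reflects-≤ (i ℕ.* M) n
      ... | false | _        = sym (ℚₚ.*-zeroʳ (powℚ B n))
      ... | true  | ofʸ iM≤n = begin
        fromℤ (a ℤ.^ i ℤ.* (b ℤ.^ e ℤ.* partialℤ J n'))
          ≡⟨ trans (fromℤ-* (a ℤ.^ i) _) (cong (fromℤ (a ℤ.^ i) ℚ.*_) (fromℤ-* (b ℤ.^ e) _)) ⟩
        fromℤ (a ℤ.^ i) ℚ.* (fromℤ (b ℤ.^ e) ℚ.* fromℤ (partialℤ J n'))
          ≡⟨ cong₂ ℚ._*_ (fromℤ-^ a i) (cong₂ ℚ._*_ (fromℤ-^ b e) (fromℤ-partialℤ J n')) ⟩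
        powℚ (fromℤ a) i ℚ.* (powℚ B e ℚ.* (powℚ B n' ℚ.* p))
          ≡⟨ cong (λ u → powℚ u i ℚ.* (powℚ B e ℚ.* (powℚ B n' ℚ.* p))) b*t≡a ⟨
        powℚ (B ℚ.* t) i ℚ.* (powℚ B e ℚ.* (powℚ B n' ℚ.* p))
          ≡⟨ cong (ℚ._* (powℚ B e ℚ.* (powℚ B n' ℚ.* p))) (powℚ-distribʳ-* B t i) ⟩
        powℚ B i ℚ.* powℚ t i ℚ.* (powℚ B e ℚ.* (powℚ B n' ℚ.* p))
          ≡⟨ rearrange (powℚ B i) (powℚ t i) (powℚ B e) (powℚ B n') p ⟩
        powℚ B i ℚ.* powℚ B e ℚ.* powℚ B n' ℚ.* (powℚ t i ℚ.* p)
          ≡⟨ cong (ℚ._* (powℚ t i ℚ.* p))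
                  (trans (powℚ-distribˡ-+-* B (i ℕ.+ e) n') (cong (ℚ._* powℚ B n') (powℚ-distribˡ-+-* B i e))) ⟨
        powℚ B (i ℕ.+ e ℕ.+ n') ℚ.* (powℚ t i ℚ.* p)
          ≡⟨ cong (λ z → powℚ B z ℚ.* (powℚ t i ℚ.* p)) (m+[n∸m]+[o∸n]≡o (ℕₚ.m≤m*n i M {{m^J≢0 J}}) iM≤n) ⟩
        powℚ B n ℚ.* (powℚ t i ℚ.* p) ∎
        where
        e  = i ℕ.* M ℕ.∸ i
        n' = n ℕ.∸ i ℕ.* M
        p  = partial m J n' t

  partialℤ-0 : ∀ y → 0 < y → partialℤ 0 y ≡ 0ℤ
  partialℤ-0 (suc y) _ = refl

  partialℤ-1 : ∀ x → partialℤ 1 x ≡ a ℤ.^ x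
  partialℤ-1 x = trans (sumℤ-single x (termℤ 0 x) ℕₚ.≤-refl vanishes) top
    where
    top : termℤ 0 x x ≡ a ℤ.^ x
    top with x ℕ.* 1 ℕ.≤ᵇ x | ℕₚ.≤ᵇ-reflects-≤ (x ℕ.* 1) x
    ... | true  | _ rewrite ℕₚ.*-identityʳ x | ℕₚ.n∸n≡0 x = ℤₚ.*-identityʳ (a ℤ.^ x)
    ... | false | ofⁿ x*1≰x = ⊥-elim (x*1≰x (ℕₚ.≤-reflexive (ℕₚ.*-identityʳ x)))

    vanishes : ∀ i → i ≢ x → termℤ 0 x i ≡ 0ℤ
    vanishes i i≢x with i ℕ.* 1 ℕ.≤ᵇ x | ℕₚ.≤ᵇ-reflects-≤ (i ℕ.* 1) x
    ... | false | _ = refl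
    ... | true  | ofʸ i*1≤x
      rewrite partialℤ-0 (x ℕ.∸ i ℕ.* 1) (ℕₚ.m<n⇒0<n∸m (ℕₚ.≤∧≢⇒< i*1≤x (i≢x ∘ trans (sym (ℕₚ.*-identityʳ i)))))
            | ℤₚ.*-zeroʳ (b ℤ.^ (i ℕ.* 1 ℕ.∸ i)) = ℤₚ.*-zeroʳ (a ℤ.^ i)

  1<m^[1+J] : ∀ J → 1 < m ℕ.^ suc J
  1<m^[1+J] J = ℕₚ.<-≤-trans (ℕ.s≤s (ℕ.s≤s ℕ.z≤n)) (ℕₚ.m≤m*n m (m ℕ.^ J) {{m^J≢0 J}})

  b∣partialℤ-a^n : ∀ J n → b ∣ partialℤ (suc J) n ℤ.- a ℤ.^ n
  b∣partialℤ-a^n zero    n =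
    subst (b ∣_) (sym (trans (cong (ℤ._- a ℤ.^ n) (partialℤ-1 n)) (ℤₚ.+-inverseʳ (a ℤ.^ n)))) ∣0ℤ
  b∣partialℤ-a^n (suc J) n = ∣-sumℤ-single n (termℤ (suc J) n) ℕ.z≤n first rest
    where
    first : b ∣ termℤ (suc J) n 0 ℤ.- a ℤ.^ n
    first = subst (λ z → b ∣ z ℤ.- a ℤ.^ n) (sym (1*[1*x]≡x (partialℤ (suc J) n))) (b∣partialℤ-a^n J n)

    rest : ∀ i → i ≢ 0 → b ∣ termℤ (suc J) n i
    rest i i≢0 with i ℕ.* m ℕ.^ suc J ℕ.≤ᵇ n
    ... | false = ∣0ℤ
    ... | true  = ∣n⇒∣m*n (a ℤ.^ i) (∣m⇒∣m*n _ (0<e⇒x∣x^e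
      (ℕₚ.m<n⇒0<n∸m (ℕₚ.m<m*n i (m ℕ.^ suc J) {{ℕ.≢-nonZero i≢0}} (1<m^[1+J] J)))))

  -- The number of parts of the greedy partition of x into the parts m ^ 0, …, m ^ J
  -- used by partialℤ (suc J).
  fewestParts : ℕ → ℕ → ℕ
  fewestParts zero    x = x
  fewestParts (suc J) x = x / P ℕ.+ fewestParts J (x % P)
    where
    P = m ℕ.^ suc J
    instance _ = m^J≢0 (suc J)

  fewestParts-≤ : ∀ J x → fewestParts J x ≤ x
  fewestParts-≤ zero    x = ℕₚ.≤-refl
  fewestParts-≤ (suc J) x = begin
    x / P ℕ.+ fewestParts J (x % P)  ≤⟨ ℕₚ.+-monoʳ-≤ (x / P) (fewestParts-≤ J (x % P)) ⟩
    x / P ℕ.+ x % P                  ≤⟨ ℕₚ.+-monoˡ-≤ (x % P) (ℕₚ.m≤m*n (x / P) P) ⟩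
    x / P ℕ.* P ℕ.+ x % P            ≡⟨ ℕₚ.+-comm (x / P ℕ.* P) (x % P) ⟩
    x % P ℕ.+ x / P ℕ.* P            ≡⟨ m≡m%n+[m/n]*n x P ⟨
    x                                ∎
    where
    open ℕₚ.≤-Reasoning
    P = m ℕ.^ suc J
    instance _ = m^J≢0 (suc J)

  fewestParts-+* : ∀ J y j → fewestParts J (y ℕ.+ j ℕ.* m ℕ.^ suc J) ≡ j ℕ.* m ℕ.+ fewestParts J y
  fewestParts-+* zero    y j rewrite ℕₚ.*-identityʳ m = ℕₚ.+-comm y (j ℕ.* m)
  fewestParts-+* (suc J) y j = begin
    (y ℕ.+ j ℕ.* (m ℕ.* P)) / P ℕ.+ fewestParts J ((y ℕ.+ j ℕ.* (m ℕ.* P)) % P)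
      ≡⟨ cong (λ z → (y ℕ.+ z) / P ℕ.+ fewestParts J ((y ℕ.+ z) % P)) (ℕₚ.*-assoc j m P) ⟨
    (y ℕ.+ j ℕ.* m ℕ.* P) / P ℕ.+ fewestParts J ((y ℕ.+ j ℕ.* m ℕ.* P) % P)
      ≡⟨ cong₂ (λ u v → u ℕ.+ fewestParts J v) quotient ([m+kn]%n≡m%n y (j ℕ.* m) P) ⟩
    (y / P ℕ.+ j ℕ.* m) ℕ.+ fewestParts J (y % P)
      ≡⟨ cong (ℕ._+ fewestParts J (y % P)) (ℕₚ.+-comm (y / P) (j ℕ.* m)) ⟩
    (j ℕ.* m ℕ.+ y / P) ℕ.+ fewestParts J (y % P)
      ≡⟨ ℕₚ.+-assoc (j ℕ.* m) (y / P) _ ⟩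
    j ℕ.* m ℕ.+ (y / P ℕ.+ fewestParts J (y % P)) ∎
    where
    open ≡-Reasoning
    P = m ℕ.^ suc J
    instance _ = m^J≢0 (suc J)
    quotient : (y ℕ.+ j ℕ.* m ℕ.* P) / P ≡ y / P ℕ.+ j ℕ.* m
    quotient = trans (+-distrib-/-∣ʳ y (divides-refl (j ℕ.* m))) (cong (y / P ℕ.+_) (m*n/n≡m (j ℕ.* m) P))

  lowestTerm : ℕ → ℕ → ℤ
  lowestTerm J x = a ℤ.^ fewestParts J x ℤ.* b ℤ.^ (x ℕ.∸ fewestParts J x)

  a^fewestParts∣partialℤ : ∀ J x → a ℤ.^ suc (fewestParts J x) ∣ partialℤ (suc J) x ℤ.- lowestTerm J x →
                           a ℤ.^ fewestParts J x ∣ partialℤ (suc J) x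
  a^fewestParts∣partialℤ J x a^[1+w]∣ =
    ∣m-n∣n⇒∣m (∣-trans (^-mono-∣ a (ℕₚ.n≤1+n (fewestParts J x))) a^[1+w]∣) (∣m⇒∣m*n _ ∣-refl)

  greedy-term : ∀ J {x q r} → x ≡ r ℕ.+ q ℕ.* m ℕ.^ suc J →
    a ℤ.^ suc (fewestParts J r) ∣ partialℤ (suc J) r ℤ.- lowestTerm J r →
    let v = q ℕ.+ fewestParts J r in
    a ℤ.^ suc v ∣ termℤ (suc J) x q ℤ.- a ℤ.^ v ℤ.* b ℤ.^ (x ℕ.∸ v)
  greedy-term J {x} {q} {r} x≡r+qP a^[1+w]∣
    with q ℕ.* m ℕ.^ suc J ℕ.≤ᵇ x | ℕₚ.≤ᵇ-reflects-≤ (q ℕ.* m ℕ.^ suc J) x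
  ... | false | ofⁿ qP≰x = ⊥-elim (qP≰x (subst (q ℕ.* m ℕ.^ suc J ≤_) (sym x≡r+qP) (ℕₚ.m≤n+m _ r)))
  ... | true  | _ =
    subst₂ _∣_ (sym a^[1+q+w]) (sym difference) (∣n⇒∣m*n (b ℤ.^ e) (*-monoʳ-∣ (a ℤ.^ q) a^[1+w]∣))
    where
    P = m ℕ.^ suc J
    w = fewestParts J r
    e = q ℕ.* P ℕ.∸ q
    s = r ℕ.∸ w
    Q = partialℤ (suc J) r

    a^[1+q+w] : a ℤ.^ suc (q ℕ.+ w) ≡ a ℤ.^ q ℤ.* a ℤ.^ suc w
    a^[1+q+w] = trans (cong (a ℤ.^_) (sym (ℕₚ.+-suc q w))) (ℤₚ.^-distribˡ-+-* a q (suc w))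

    x∸[q+w]≡e+s : x ℕ.∸ (q ℕ.+ w) ≡ e ℕ.+ s
    x∸[q+w]≡e+s = begin
      x ℕ.∸ (q ℕ.+ w)                 ≡⟨ cong (ℕ._∸ (q ℕ.+ w)) (trans x≡r+qP (ℕₚ.+-comm r (q ℕ.* P))) ⟩
      (q ℕ.* P ℕ.+ r) ℕ.∸ (q ℕ.+ w)
        ≡⟨ [m+n]∸[o+p]≡[m∸o]+[n∸p] (ℕₚ.m≤m*n q P {{m^J≢0 (suc J)}}) (fewestParts-≤ J r) ⟩
      e ℕ.+ s                         ∎
      where open ≡-Reasoning

    factor : ∀ A B Q W S → A ℤ.* (B ℤ.* Q) ℤ.- A ℤ.* W ℤ.* (B ℤ.* S) ≡ B ℤ.* (A ℤ.* (Q ℤ.- W ℤ.* S))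
    factor = solve-∀

    difference :
      a ℤ.^ q ℤ.* (b ℤ.^ e ℤ.* partialℤ (suc J) (x ℕ.∸ q ℕ.* P)) ℤ.- a ℤ.^ (q ℕ.+ w) ℤ.* b ℤ.^ (x ℕ.∸ (q ℕ.+ w))
        ≡ b ℤ.^ e ℤ.* (a ℤ.^ q ℤ.* (Q ℤ.- lowestTerm J r))
    difference = begin
      a ℤ.^ q ℤ.* (b ℤ.^ e ℤ.* partialℤ (suc J) (x ℕ.∸ q ℕ.* P)) ℤ.- a ℤ.^ (q ℕ.+ w) ℤ.* b ℤ.^ (x ℕ.∸ (q ℕ.+ w))
        ≡⟨ cong₂ (λ y z → a ℤ.^ q ℤ.* (b ℤ.^ e ℤ.* partialℤ (suc J) y) ℤ.- a ℤ.^ (q ℕ.+ w) ℤ.* b ℤ.^ z)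
                 (trans (cong (ℕ._∸ q ℕ.* P) x≡r+qP) (ℕₚ.m+n∸n≡m r (q ℕ.* P))) x∸[q+w]≡e+s ⟩
      a ℤ.^ q ℤ.* (b ℤ.^ e ℤ.* Q) ℤ.- a ℤ.^ (q ℕ.+ w) ℤ.* b ℤ.^ (e ℕ.+ s)
        ≡⟨ cong₂ (λ u z → a ℤ.^ q ℤ.* (b ℤ.^ e ℤ.* Q) ℤ.- u ℤ.* z)
                 (ℤₚ.^-distribˡ-+-* a q w) (ℤₚ.^-distribˡ-+-* b e s) ⟩
      a ℤ.^ q ℤ.* (b ℤ.^ e ℤ.* Q) ℤ.- a ℤ.^ q ℤ.* a ℤ.^ w ℤ.* (b ℤ.^ e ℤ.* b ℤ.^ s)
        ≡⟨ factor (a ℤ.^ q) (b ℤ.^ e) Q (a ℤ.^ w) (b ℤ.^ s) ⟩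
      b ℤ.^ e ℤ.* (a ℤ.^ q ℤ.* (Q ℤ.- lowestTerm J r)) ∎
      where open ≡-Reasoning

  non-greedy-terms : ∀ J {x q r} → x ≡ r ℕ.+ q ℕ.* m ℕ.^ suc J → r < m ℕ.^ suc J →
    (∀ y → a ℤ.^ fewestParts J y ∣ partialℤ (suc J) y) →
    ∀ i → i ≢ q → a ℤ.^ suc (q ℕ.+ fewestParts J r) ∣ termℤ (suc J) x i
  non-greedy-terms J {x} {q} {r} x≡r+qP r<P a^fewestParts∣ i i≢q
    with i ℕ.* m ℕ.^ suc J ℕ.≤ᵇ x | ℕₚ.≤ᵇ-reflects-≤ (i ℕ.* m ℕ.^ suc J) x
  ... | false | _ = ∣0ℤ
  ... | true  | ofʸ iP≤x = ∣-trans (^-mono-∣ a exponent) a^[i+w']∣term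
    where
    P = m ℕ.^ suc J
    w = fewestParts J r
    j = q ℕ.∸ i
    y = x ℕ.∸ i ℕ.* P

    i<q : i < q
    i<q = ℕₚ.≤∧≢⇒< (ℕₚ.≤-pred (ℕₚ.*-cancelʳ-< P i (suc q) (begin-strict
      i ℕ.* P          ≤⟨ iP≤x ⟩
      x                ≡⟨ x≡r+qP ⟩
      r ℕ.+ q ℕ.* P    <⟨ ℕₚ.+-monoˡ-< (q ℕ.* P) r<P ⟩
      suc q ℕ.* P      ∎))) i≢q
      where open ℕₚ.≤-Reasoning

    fewestParts-y : fewestParts J y ≡ j ℕ.* m ℕ.+ w
    fewestParts-y = trans
      (cong (fewestParts J) (trans (cong (ℕ._∸ i ℕ.* P) x≡r+qP) (m+n*o∸p*o≡m+[n∸p]*o r P (ℕₚ.<⇒≤ i<q))))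
      (fewestParts-+* J r j)

    a^[i+w']∣term :
      a ℤ.^ (i ℕ.+ fewestParts J y) ∣ a ℤ.^ i ℤ.* (b ℤ.^ (i ℕ.* P ℕ.∸ i) ℤ.* partialℤ (suc J) y)
    a^[i+w']∣term = subst (_∣ a ℤ.^ i ℤ.* (b ℤ.^ (i ℕ.* P ℕ.∸ i) ℤ.* partialℤ (suc J) y))
      (sym (ℤₚ.^-distribˡ-+-* a i (fewestParts J y)))
      (*-monoʳ-∣ (a ℤ.^ i) (∣n⇒∣m*n (b ℤ.^ (i ℕ.* P ℕ.∸ i)) (a^fewestParts∣ y)))

    -- Taking i < q copies of m ^ suc J leaves j · m ^ suc J to smaller parts, which
    -- costs at least j · m > j additional parts.
    exponent : suc (q ℕ.+ w) ≤ i ℕ.+ fewestParts J y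
    exponent = begin
      suc (q ℕ.+ w)            ≡⟨ cong (λ z → suc (z ℕ.+ w)) (ℕₚ.m+[n∸m]≡n (ℕₚ.<⇒≤ i<q)) ⟨
      suc (i ℕ.+ j ℕ.+ w)      ≡⟨ rearrange i j w ⟩
      i ℕ.+ (suc j ℕ.+ w)      ≤⟨ ℕₚ.+-monoʳ-≤ i (ℕₚ.+-monoˡ-≤ w (ℕₚ.m<m*n j m {{j≢0}} (ℕ.s≤s (ℕ.s≤s ℕ.z≤n)))) ⟩
      i ℕ.+ (j ℕ.* m ℕ.+ w)    ≡⟨ cong (i ℕ.+_) fewestParts-y ⟨
      i ℕ.+ fewestParts J y    ∎
      where
      open ℕₚ.≤-Reasoning
      j≢0 : ℕ.NonZero j
      j≢0 = ℕ.>-nonZero (ℕₚ.m<n⇒0<n∸m i<q)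
      rearrange : ∀ i j w → suc (i ℕ.+ j ℕ.+ w) ≡ i ℕ.+ (suc j ℕ.+ w)
      rearrange = ℕ-Solver.solve-∀

  a^[1+fewestParts]∣partialℤ-lowestTerm : ∀ J x →
    a ℤ.^ suc (fewestParts J x) ∣ partialℤ (suc J) x ℤ.- lowestTerm J x
  a^[1+fewestParts]∣partialℤ-lowestTerm zero x = subst (_ ∣_) (sym vanishes) ∣0ℤ
    where
    vanishes : partialℤ 1 x ℤ.- a ℤ.^ x ℤ.* b ℤ.^ (x ℕ.∸ x) ≡ 0ℤ
    vanishes rewrite partialℤ-1 x | ℕₚ.n∸n≡0 x | ℤₚ.*-identityʳ (a ℤ.^ x) = ℤₚ.+-inverseʳ (a ℤ.^ x)
  a^[1+fewestParts]∣partialℤ-lowestTerm (suc J) x =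
    ∣-sumℤ-single x (termℤ (suc J) x) (m/n≤m x P)
      (greedy-term J {x} {x / P} {x % P} x≡r+qP (IH (x % P)))
      (non-greedy-terms J {x} {x / P} {x % P} x≡r+qP (m%n<n x P)
        (λ y → a^fewestParts∣partialℤ J y (IH y)))
    where
    P = m ℕ.^ suc J
    instance _ = m^J≢0 (suc J)
    x≡r+qP = m≡m%n+[m/n]*n x P
    IH = a^[1+fewestParts]∣partialℤ-lowestTerm J

module _ (k : ℕ) where
  open Homogenised k 1ℤ 1ℤ

  1≤partialℤ : ∀ J x → 1ℤ ℤ.≤ partialℤ (suc J) x
  1≤partialℤ zero    x = ℤₚ.≤-reflexive (sym (trans (partialℤ-1 x) (ℤₚ.^-zeroˡ x)))
  1≤partialℤ (suc J) x = ℤₚ.≤-trans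
    (subst (1ℤ ℤ.≤_) (sym (1*[1*x]≡x (partialℤ (suc J) x))) (1≤partialℤ J x))
    (f0≤sumℤ x (termℤ (suc J) x) 0≤term)
    where
    0≤term : ∀ i → 0ℤ ℤ.≤ termℤ (suc J) x i
    0≤term i with i ℕ.* m ℕ.^ suc J ℕ.≤ᵇ x
    ... | false = ℤₚ.≤-refl
    ... | true  rewrite ℤₚ.^-zeroˡ i | ℤₚ.^-zeroˡ (i ℕ.* m ℕ.^ suc J ℕ.∸ i) =
      subst (0ℤ ℤ.≤_) (sym (1*[1*x]≡x (partialℤ (suc J) y))) (ℤₚ.≤-trans (ℤ.+≤+ ℕ.z≤n) (1≤partialℤ J y))
      where y = x ℕ.∸ i ℕ.* m ℕ.^ suc J

coprime-∣-^⇒∣1 : ∀ {d} (x : ℤ) n → Coprime d ℤ.∣ x ∣ → d ∣ℕ ℤ.∣ x ℤ.^ n ∣ → d ∣ℕ 1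
coprime-∣-^⇒∣1 x zero    _   d∣1 = d∣1
coprime-∣-^⇒∣1 x (suc n) d⊥x d∣x^[1+n] =
  coprime-∣-^⇒∣1 x n d⊥x (coprime-divisor d⊥x (subst (_ ∣ℕ_) (ℤₚ.abs-* x (x ℤ.^ n)) d∣x^[1+n]))

x^[1+n]∣x^n⇒x∣1 : ∀ {x : ℤ} n → x ≢ 0ℤ → x ℤ.^ suc n ∣ x ℤ.^ n → x ∣ 1ℤ
x^[1+n]∣x^n⇒x∣1 {x} n x≢0 x^[1+n]∣x^n =
  *-cancelʳ-∣ (x ℤ.^ n) {{ℤ.≢-nonZero (x≢0 ∘ ℤₚ.i^n≡0⇒i≡0 x n)}}
  (subst (x ℤ.* x ℤ.^ n ∣_) (sym (ℤₚ.*-identityˡ (x ℤ.^ n))) x^[1+n]∣x^n)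

root⇒partialℤ≡0 : ∀ k n r → pm (suc (suc k)) n r ≡ 0ℚ →
                  Homogenised.partialℤ k (↥ r) (↧ r) (suc n) n ≡ 0ℤ
root⇒partialℤ≡0 k n r root = cong ↥_ (begin
  fromℤ (partialℤ (suc n) n)            ≡⟨ fromℤ-partialℤ (↧p*p≡↥p r) (suc n) n ⟩
  powℚ (fromℤ (↧ r)) n ℚ.* pm m n r     ≡⟨ cong (powℚ (fromℤ (↧ r)) n ℚ.*_) root ⟩
  powℚ (fromℤ (↧ r)) n ℚ.* 0ℚ           ≡⟨ ℚₚ.*-zeroʳ (powℚ (fromℤ (↧ r)) n) ⟩
  0ℚ                                    ∎)
  where
  open Homogenised k (↥ r) (↧ r)
  open ≡-Reasoning

root-denominator≡1 : ∀ k n r → Homogenised.partialℤ k (↥ r) (↧ r) (suc n) n ≡ 0ℤ → ↧ₙ r ≡ 1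
root-denominator≡1 k n (mkℚ a d a⊥d) root =
  ∣1⇒≡1 (coprime-∣-^⇒∣1 a n (coprime-sym (recompute a⊥d)) (∣⇒∣ᵤ b∣a^n))
  where
  open Homogenised k a (+ suc d)
  b∣a^n : + suc d ∣ a ℤ.^ n
  b∣a^n = m≡0⇒∣m-n⇒∣n root (b∣partialℤ-a^n n n)

integer-root⇒∣a∣≡1 : ∀ k n a → a ≢ 0ℤ → Homogenised.partialℤ k a 1ℤ (suc n) n ≡ 0ℤ → ℤ.∣ a ∣ ≡ 1
integer-root⇒∣a∣≡1 k n a a≢0 root = ∣1⇒≡1 (∣⇒∣ᵤ (x^[1+n]∣x^n⇒x∣1 w a≢0 a^[1+w]∣a^w))
  where
  open Homogenised k a 1ℤ
  w = fewestParts n n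

  lowestTerm≡a^w : lowestTerm n n ≡ a ℤ.^ w
  lowestTerm≡a^w = trans (cong (a ℤ.^ w ℤ.*_) (ℤₚ.^-zeroˡ (n ℕ.∸ w))) (ℤₚ.*-identityʳ (a ℤ.^ w))

  a^[1+w]∣a^w : a ℤ.^ suc w ∣ a ℤ.^ w
  a^[1+w]∣a^w = subst (a ℤ.^ suc w ∣_) lowestTerm≡a^w
    (m≡0⇒∣m-n⇒∣n root (a^[1+fewestParts]∣partialℤ-lowestTerm n n))

integer-root : ∀ k n a → Homogenised.partialℤ k a 1ℤ (suc n) n ≡ 0ℤ → a ≡ -1ℤ ⊎ a ≡ 0ℤ
integer-root k n (+ 0)    _ = inj₂ refl
integer-root k n -[1+ 0 ] _ = inj₁ refl
integer-root k n (+ 1) root with subst (1ℤ ℤ.≤_) root (1≤partialℤ k n n)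
... | ℤ.+≤+ ()
integer-root k n (+ suc (suc _)) root with integer-root⇒∣a∣≡1 k n _ (λ ()) root
... | ()
integer-root k n -[1+ suc _ ] root with integer-root⇒∣a∣≡1 k n _ (λ ()) root
... | ()

lemma3p1 : (m n : ℕ) → 2 ≤ m → (r : ℚ) → pm m n r ≡ 0ℚ → (r ≡ - 1ℚ) ⊎ (r ≡ 0ℚ)
lemma3p1 (suc zero)    _ (ℕ.s≤s ()) _ _
lemma3p1 (suc (suc k)) n _ r@(mkℚ a _ _) root
  with root-denominator≡1 k n r (root⇒partialℤ≡0 k n r root)
... | refl with integer-root k n a (root⇒partialℤ≡0 k n r root)
...   | inj₁ refl = inj₁ refl
...   | inj₂ refl = inj₂ refl
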